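{- Let $k\ge1$ be an integer and $C_k=\frac{1}{k+1}\binom{2k}{k}$ the $k$-th Catalan number. If $\alpha(J(2k,k)) = C_k$, then $\theta(J(2k,k)) = C_k$.
   Context: For integers $0<k<N$, the Johnson graph $J(N,k)$ has as vertices the $k$-element subsets of $\{1,\dots,N\}$, two being adjacent iff they share exactly $k-1$ elements. $\alpha(G)$ denotes the independence number of a graph $G$, and $\theta(G)$ the smallest number of cliques of $G$ whose vertex sets together cover all vertices of $G$. -}

module Defs where

open import Level using (0ℓ)
open import Data.Nat using (ℕ; zero; suc; _+_; _*_; _∸_; _≤_)
open import Data.Nat.DivMod using (_/_)
open import Data.Nat.Combinatorics using (_C_)
open import Data.Bool using (Bool; true)
open import Data.Fin using (Fin)
open import Data.Fin.Subset using (Subset; _∩_; ∣_∣)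
open import Data.Product using (Σ; ∃; ∃-syntax; _×_; proj₁)
open import Relation.Binary.PropositionalEquality using (_≡_; _≢_)
open import Function.Definitions using (Injective)

record Graph : Set₁ where
  field
    Vertex : Set
    Adj    : Vertex → Vertex → Set

open Graph public

JVertex : ℕ → ℕ → Set
JVertex N k = Σ (Subset N) (λ s → ∣ s ∣ ≡ k)

Johnson : ℕ → ℕ → Graph
Johnson N k = record
  { Vertex = JVertex N k
  ; Adj    = λ u v → ∣ proj₁ u ∩ proj₁ v ∣ ≡ k ∸ 1
  }

IndependentSet : (G : Graph) → ℕ → Set
IndependentSet G m =
  Σ (Fin m → Vertex G) λ f →
    Injective _≡_ _≡_ f × (∀ i j → i ≢ j → Adj G (f i) (f j) → Data.Empty.⊥)
  where import Data.Empty

IsIndependenceNumber : Graph → ℕ → Set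
IsIndependenceNumber G m =
  IndependentSet G m × (∀ m' → IndependentSet G m' → m' ≤ m)

IsClique : (G : Graph) → (Vertex G → Bool) → Set
IsClique G C = ∀ u v → C u ≡ true → C v ≡ true → u ≢ v → Adj G u v

CliqueCover : (G : Graph) → ℕ → Set
CliqueCover G m =
  Σ (Fin m → Vertex G → Bool) λ C →
    (∀ i → IsClique G (C i)) × (∀ v → ∃[ i ] C i v ≡ true)

IsCliqueCoverNumber : Graph → ℕ → Set
IsCliqueCoverNumber G m =
  CliqueCover G m × (∀ m' → CliqueCover G m' → m ≤ m')

catalan : ℕ → ℕ
catalan k = ((2 * k) C k) / suc k

-- θ ≥ α in every graph, since the vertices of an independent set lie in distinct cliques.  Conversely,
-- let I be an independent set of C_k vertices of J(2k,k): k-sets no two of which meet in k−1 points.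
-- Deleting one point from a member of I gives k·C_k distinct (k−1)-sets, and k·C_k = (2k choose k−1),
-- so every (k−1)-set lies in a member of I; as complementation is an automorphism of J(2k,k), every
-- (k+1)-set likewise contains a member of I.  Fix a point 0 and attach to c ∈ I the clique of k-sets
-- containing c − 0 if 0 ∈ c, resp. contained in c ∪ {0} if 0 ∉ c.  A vertex v ∋ 0 lies in the clique
-- of a member containing v − 0, and a vertex v ∌ 0 in the clique of a member inside v ∪ {0}.

module Submission where

open import Defs
import Algebra.Lattice.Properties.BooleanAlgebra as BooleanAlgebraProperties
open import Data.Bool using (Bool; true)
open import Data.Empty using (⊥-elim)
open import Data.Fin using (Fin; zero; suc; remQuot; combine)
open import Data.Fin.Properties as Finₚ using (any?; combine-remQuot; injective⇒≤) renaming (_≟_ to _≟ᶠ_)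
open import Data.Fin.Subset
  using (Subset; inside; outside; _∈_; _∉_; _⊆_; _∩_; _∪_; _-_; ∁; ⁅_⁆; ∣_∣)
open import Data.Fin.Subset.Properties
open import Data.List as List using (List; _++_; map; length; lookup)
open import Data.List.Properties using (length-++; length-map)
open import Data.List.Membership.Propositional using () renaming (_∈_ to _∈ˡ_)
open import Data.List.Membership.Propositional.Properties using (∈-++⁺ˡ; ∈-++⁺ʳ; ∈-map⁺)
open import Data.List.Relation.Unary.Any using (here; index)
open import Data.List.Relation.Unary.Any.Properties using (lookup-index)
open import Data.Nat using (ℕ; suc; _+_; _*_; _∸_; _≤_; _<_; s≤s; s≤s⁻¹; _≤?_)
open import Data.Nat.Combinatorics using (_C_; nCk+nC[k+1]≡[n+1]C[k+1]; nCk≡nC[n∸k]; nC1≡n)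
open import Data.Nat.DivMod using (_/_; m*n/n≡m)
open import Data.Nat.Properties
open import Data.Nat.Tactic.RingSolver using (solve-∀)
open import Data.Product using (∃; _×_; _,_; proj₁; proj₂; uncurry)
open import Data.Product.Properties using (Σ-≡,≡→≡)
open import Data.Sum using (_⊎_; inj₁; inj₂; [_,_])
open import Data.Vec using ([]; _∷_; here; there)
open import Function using (_∘_)
open import Function.Definitions using (Injective)
open import Relation.Binary.PropositionalEquality
  using (_≡_; _≢_; refl; sym; trans; cong; cong₂; subst; subst-injective; module ≡-Reasoning)
open import Relation.Nullary using (Dec; yes; no; does)
open import Relation.Nullary.Decidable using (dec-true; _⊎-dec_)

private
  variable
    n m r : ℕ
    x y : Fin n
    p q : Subset n

-- Subsets of Fin n

∣p∩q∣+∣p∪q∣≡∣p∣+∣q∣ : (p q : Subset n) → ∣ p ∩ q ∣ + ∣ p ∪ q ∣ ≡ ∣ p ∣ + ∣ q ∣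
∣p∩q∣+∣p∪q∣≡∣p∣+∣q∣ [] [] = refl
∣p∩q∣+∣p∪q∣≡∣p∣+∣q∣ (inside ∷ p) (inside ∷ q) =
  cong suc (trans (+-suc _ _) (trans (cong suc (∣p∩q∣+∣p∪q∣≡∣p∣+∣q∣ p q)) (sym (+-suc _ _))))
∣p∩q∣+∣p∪q∣≡∣p∣+∣q∣ (inside ∷ p) (outside ∷ q) =
  trans (+-suc _ _) (cong suc (∣p∩q∣+∣p∪q∣≡∣p∣+∣q∣ p q))
∣p∩q∣+∣p∪q∣≡∣p∣+∣q∣ (outside ∷ p) (inside ∷ q) =
  trans (+-suc _ _) (trans (cong suc (∣p∩q∣+∣p∪q∣≡∣p∣+∣q∣ p q)) (sym (+-suc _ _)))
∣p∩q∣+∣p∪q∣≡∣p∣+∣q∣ (outside ∷ p) (outside ∷ q) = ∣p∩q∣+∣p∪q∣≡∣p∣+∣q∣ p q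

p⊆q∧∣q∣≤∣p∣⇒p≡q : p ⊆ q → ∣ q ∣ ≤ ∣ p ∣ → p ≡ q
p⊆q∧∣q∣≤∣p∣⇒p≡q {p = []} {[]} _ _ = refl
p⊆q∧∣q∣≤∣p∣⇒p≡q {p = inside ∷ p} {inside ∷ q} p⊆q ∣q∣≤∣p∣ =
  cong (inside ∷_) (p⊆q∧∣q∣≤∣p∣⇒p≡q (drop-∷-⊆ p⊆q) (s≤s⁻¹ ∣q∣≤∣p∣))
p⊆q∧∣q∣≤∣p∣⇒p≡q {p = inside ∷ p} {outside ∷ q} p⊆q _ with p⊆q here
... | ()
p⊆q∧∣q∣≤∣p∣⇒p≡q {p = outside ∷ p} {inside ∷ q} p⊆q ∣q∣≤∣p∣ =
  ⊥-elim (<-irrefl refl (≤-trans (s≤s (p⊆q⇒∣p∣≤∣q∣ (drop-∷-⊆ p⊆q))) ∣q∣≤∣p∣))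
p⊆q∧∣q∣≤∣p∣⇒p≡q {p = outside ∷ p} {outside ∷ q} p⊆q ∣q∣≤∣p∣ =
  cong (outside ∷_) (p⊆q∧∣q∣≤∣p∣⇒p≡q (drop-∷-⊆ p⊆q) ∣q∣≤∣p∣)

∣p∣≡∣q∣∧p⊆q⇒p≡q : ∣ p ∣ ≡ ∣ q ∣ → p ⊆ q → p ≡ q
∣p∣≡∣q∣∧p⊆q⇒p≡q ∣p∣≡∣q∣ p⊆q = p⊆q∧∣q∣≤∣p∣⇒p≡q p⊆q (≤-reflexive (sym ∣p∣≡∣q∣))

p≢q⇒∣p∩q∣<s : ∀ {s} → ∣ p ∣ ≡ s → ∣ q ∣ ≡ s → p ≢ q → ∣ p ∩ q ∣ < s
p≢q⇒∣p∩q∣<s {p = p} {q} {s} ∣p∣≡s ∣q∣≡s p≢q with s ≤? ∣ p ∩ q ∣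
... | no s≰∣p∩q∣ = ≰⇒> s≰∣p∩q∣
... | yes s≤∣p∩q∣ = ⊥-elim (p≢q (trans (sym (meet≡ (p∩q⊆p p q) ∣p∣≡s)) (meet≡ (p∩q⊆q p q) ∣q∣≡s)))
  where
    meet≡ : ∀ {t} → p ∩ q ⊆ t → ∣ t ∣ ≡ s → p ∩ q ≡ t
    meet≡ ⊆t ∣t∣≡s = p⊆q∧∣q∣≤∣p∣⇒p≡q ⊆t (subst (_≤ ∣ p ∩ q ∣) (sym ∣t∣≡s) s≤∣p∩q∣)

x∈p⇒suc∣p-x∣≡∣p∣ : x ∈ p → suc ∣ p - x ∣ ≡ ∣ p ∣
x∈p⇒suc∣p-x∣≡∣p∣ {x = zero} {inside ∷ p} here = cong (suc ∘ ∣_∣) (p─⊥≡p p)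
x∈p⇒suc∣p-x∣≡∣p∣ {x = suc x} {inside ∷ p} (there x∈p) = cong suc (x∈p⇒suc∣p-x∣≡∣p∣ x∈p)
x∈p⇒suc∣p-x∣≡∣p∣ {x = suc x} {outside ∷ p} (there x∈p) = x∈p⇒suc∣p-x∣≡∣p∣ x∈p

x∈p∧∣p∣≡1+r⇒∣p-x∣≡r : x ∈ p → ∣ p ∣ ≡ suc r → ∣ p - x ∣ ≡ r
x∈p∧∣p∣≡1+r⇒∣p-x∣≡r x∈p ∣p∣≡1+r = suc-injective (trans (x∈p⇒suc∣p-x∣≡∣p∣ x∈p) ∣p∣≡1+r)

x∉p⇒∣p∪⁅x⁆∣≡suc∣p∣ : x ∉ p → ∣ p ∪ ⁅ x ⁆ ∣ ≡ suc ∣ p ∣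
x∉p⇒∣p∪⁅x⁆∣≡suc∣p∣ {x = zero} {inside ∷ p} x∉p = ⊥-elim (x∉p here)
x∉p⇒∣p∪⁅x⁆∣≡suc∣p∣ {x = zero} {outside ∷ p} x∉p = cong (suc ∘ ∣_∣) (∪-identityʳ p)
x∉p⇒∣p∪⁅x⁆∣≡suc∣p∣ {x = suc x} {inside ∷ p} x∉p = cong suc (x∉p⇒∣p∪⁅x⁆∣≡suc∣p∣ (x∉p ∘ there))
x∉p⇒∣p∪⁅x⁆∣≡suc∣p∣ {x = suc x} {outside ∷ p} x∉p = x∉p⇒∣p∪⁅x⁆∣≡suc∣p∣ (x∉p ∘ there)

x∉p-x : (p : Subset n) → x ∉ p - x
x∉p-x {x = zero} (_ ∷ p) ()
x∉p-x {x = suc x} (_ ∷ p) (there x∈p-x) = x∉p-x p x∈p-x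

x∈p-y⇒x≢y : x ∈ p - y → x ≢ y
x∈p-y⇒x≢y {p = p} x∈p-x refl = x∉p-x p x∈p-x

x∈p∪⁅y⁆⇒x∈p⊎x≡y : x ∈ p ∪ ⁅ y ⁆ → x ∈ p ⊎ x ≡ y
x∈p∪⁅y⁆⇒x∈p⊎x≡y {p = p} {y} x∈ with x∈p∪q⁻ p ⁅ y ⁆ x∈
... | inj₁ x∈p = inj₁ x∈p
... | inj₂ x∈⁅y⁆ = inj₂ (x∈⁅y⁆⇒x≡y y x∈⁅y⁆)

p⊆q∪⁅x⁆⇒p-x⊆q : p ⊆ q ∪ ⁅ x ⁆ → p - x ⊆ q
p⊆q∪⁅x⁆⇒p-x⊆q {p = p} {x = x} p⊆ y∈p-x with x∈p∪⁅y⁆⇒x∈p⊎x≡y (p⊆ (p─q⊆p p ⁅ x ⁆ y∈p-x))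
... | inj₁ y∈q = y∈q
... | inj₂ y≡x = ⊥-elim (x∈p-y⇒x≢y y∈p-x y≡x)

p-x⊆q⇒p⊆q∪⁅x⁆ : p - x ⊆ q → p ⊆ q ∪ ⁅ x ⁆
p-x⊆q⇒p⊆q∪⁅x⁆ {x = x} p-x⊆q {y} y∈p with y ≟ᶠ x
... | yes refl = x∈p∪q⁺ (inj₂ (x∈⁅x⁆ x))
... | no y≢x = x∈p∪q⁺ (inj₁ (p-x⊆q (x∈p∧x≢y⇒x∈p-y y∈p y≢x)))

p⊆q∪⁅x⁆⇒p⊆q : p ⊆ q ∪ ⁅ x ⁆ → (x ∈ p → x ∈ q) → p ⊆ q
p⊆q∪⁅x⁆⇒p⊆q p⊆ x∈p⇒x∈q y∈p with x∈p∪⁅y⁆⇒x∈p⊎x≡y (p⊆ y∈p)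
... | inj₁ y∈q = y∈q
... | inj₂ refl = x∈p⇒x∈q y∈p

∁p-x⊆∁q⇒q⊆p∪⁅x⁆ : ∁ p - x ⊆ ∁ q → q ⊆ p ∪ ⁅ x ⁆
∁p-x⊆∁q⇒q⊆p∪⁅x⁆ {p = p} {x = x} ∁p-x⊆∁q {y} y∈q with y ∈? p | y ≟ᶠ x
... | yes y∈p | _ = x∈p∪q⁺ (inj₁ y∈p)
... | no _ | yes refl = x∈p∪q⁺ (inj₂ (x∈⁅x⁆ x))
... | no y∉p | no y≢x = ⊥-elim (x∈p⇒x∉∁p y∈q (∁p-x⊆∁q (x∈p∧x≢y⇒x∈p-y (x∉p⇒x∈∁p y∉p) y≢x)))

x∈p∧p-x≡p-y⇒x≡y : x ∈ p → p - x ≡ p - y → x ≡ y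
x∈p∧p-x≡p-y⇒x≡y {x = x} {p = p} {y = y} x∈p p-x≡p-y with x ≟ᶠ y
... | yes x≡y = x≡y
... | no x≢y = ⊥-elim (x∉p-x p (subst (x ∈_) (sym p-x≡p-y) (x∈p∧x≢y⇒x∈p-y x∈p x≢y)))

∁-injective : ∁ p ≡ ∁ q → p ≡ q
∁-injective {n} {p} {q} ∁p≡∁q = trans (sym (¬-involutive p)) (trans (cong ∁ ∁p≡∁q) (¬-involutive q))
  where open BooleanAlgebraProperties (∪-∩-booleanAlgebra n)

∣∁p∩∁q∣≡∣p∩q∣ : (p q : Subset n) → ∣ p ∣ + ∣ q ∣ ≡ n → ∣ ∁ p ∩ ∁ q ∣ ≡ ∣ p ∩ q ∣
∣∁p∩∁q∣≡∣p∩q∣ {n} p q ∣p∣+∣q∣≡n = begin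
  ∣ ∁ p ∩ ∁ q ∣              ≡⟨ cong ∣_∣ (sym (deMorgan₂ p q)) ⟩
  ∣ ∁ (p ∪ q) ∣              ≡⟨ ∣∁p∣≡n∸∣p∣ (p ∪ q) ⟩
  n ∸ ∣ p ∪ q ∣              ≡⟨ cong (_∸ ∣ p ∪ q ∣) (trans (sym ∣p∣+∣q∣≡n) (sym (∣p∩q∣+∣p∪q∣≡∣p∣+∣q∣ p q))) ⟩
  ∣ p ∩ q ∣ + ∣ p ∪ q ∣ ∸ ∣ p ∪ q ∣  ≡⟨ m+n∸n≡m ∣ p ∩ q ∣ ∣ p ∪ q ∣ ⟩
  ∣ p ∩ q ∣                  ∎
  where
    open ≡-Reasoning
    open BooleanAlgebraProperties (∪-∩-booleanAlgebra n)

-- Enumerations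

element : (p : Subset n) → Fin ∣ p ∣ → Fin n
element (inside ∷ p) zero = zero
element (inside ∷ p) (suc t) = suc (element p t)
element (outside ∷ p) t = suc (element p t)

element-∈ : (p : Subset n) (t : Fin ∣ p ∣) → element p t ∈ p
element-∈ (inside ∷ p) zero = here
element-∈ (inside ∷ p) (suc t) = there (element-∈ p t)
element-∈ (outside ∷ p) t = there (element-∈ p t)

element-injective : (p : Subset n) → Injective _≡_ _≡_ (element p)
element-injective (inside ∷ p) {zero} {zero} _ = refl
element-injective (inside ∷ p) {suc s} {suc t} e = cong suc (element-injective p (Finₚ.suc-injective e))
element-injective (outside ∷ p) e = element-injective p (Finₚ.suc-injective e)

subsetsOfSize : ∀ n → ℕ → List (Subset n)
subsetsOfSize 0 0 = List.[ [] ]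
subsetsOfSize 0 (suc r) = List.[]
subsetsOfSize (suc n) 0 = map (outside ∷_) (subsetsOfSize n 0)
subsetsOfSize (suc n) (suc r) =
  map (outside ∷_) (subsetsOfSize n (suc r)) ++ map (inside ∷_) (subsetsOfSize n r)

length-subsetsOfSize : ∀ n r → length (subsetsOfSize n r) ≡ n C r
length-subsetsOfSize 0 0 = refl
length-subsetsOfSize 0 (suc r) = refl
length-subsetsOfSize (suc n) 0 = begin
  length (map (outside ∷_) (subsetsOfSize n 0)) ≡⟨ length-map (outside ∷_) (subsetsOfSize n 0) ⟩
  length (subsetsOfSize n 0)                    ≡⟨ length-subsetsOfSize n 0 ⟩
  n C 0                                         ≡⟨ nC0≡[1+n]C0 n ⟩
  suc n C 0                                     ∎
  where
    open ≡-Reasoning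
    nC0≡[1+n]C0 : ∀ n → n C 0 ≡ suc n C 0
    nC0≡[1+n]C0 0 = refl
    nC0≡[1+n]C0 (suc n) = refl
length-subsetsOfSize (suc n) (suc r) = begin
  length (map (outside ∷_) (subsetsOfSize n (suc r)) ++ map (inside ∷_) (subsetsOfSize n r))
    ≡⟨ length-++ (map (outside ∷_) (subsetsOfSize n (suc r))) ⟩
  length (map (outside ∷_) (subsetsOfSize n (suc r))) + length (map (inside ∷_) (subsetsOfSize n r))
    ≡⟨ cong₂ _+_ (length-map (outside ∷_) (subsetsOfSize n (suc r))) (length-map (inside ∷_) (subsetsOfSize n r)) ⟩
  length (subsetsOfSize n (suc r)) + length (subsetsOfSize n r)
    ≡⟨ cong₂ _+_ (length-subsetsOfSize n (suc r)) (length-subsetsOfSize n r) ⟩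
  n C suc r + n C r
    ≡⟨ +-comm (n C suc r) (n C r) ⟩
  n C r + n C suc r
    ≡⟨ nCk+nC[k+1]≡[n+1]C[k+1] n r ⟩
  suc n C suc r
    ∎
  where open ≡-Reasoning

p∈subsetsOfSize∣p∣ : (p : Subset n) → p ∈ˡ subsetsOfSize n ∣ p ∣
p∈subsetsOfSize∣p∣ [] = here refl
p∈subsetsOfSize∣p∣ (outside ∷ p) with ∣ p ∣ | p∈subsetsOfSize∣p∣ p
... | 0 | p∈ = ∈-map⁺ (outside ∷_) p∈
... | suc _ | p∈ = ∈-++⁺ˡ (∈-map⁺ (outside ∷_) p∈)
p∈subsetsOfSize∣p∣ {suc n} (inside ∷ p) =
  ∈-++⁺ʳ (map (outside ∷_) (subsetsOfSize n (suc ∣ p ∣))) (∈-map⁺ (inside ∷_) (p∈subsetsOfSize∣p∣ p))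

∈-index-injective : ∀ {A : Set} {a b : A} {xs : List A} (a∈ : a ∈ˡ xs) (b∈ : b ∈ˡ xs) →
                    index a∈ ≡ index b∈ → a ≡ b
∈-index-injective {xs = xs} a∈ b∈ same =
  trans (lookup-index a∈) (trans (cong (lookup xs) same) (sym (lookup-index b∈)))

∈-subsetsOfSize : (p : Subset n) → ∣ p ∣ ≡ r → p ∈ˡ subsetsOfSize n r
∈-subsetsOfSize p refl = p∈subsetsOfSize∣p∣ p

rank : (p : Subset n) → ∣ p ∣ ≡ r → Fin (length (subsetsOfSize n r))
rank p ∣p∣≡r = index (∈-subsetsOfSize p ∣p∣≡r)

rank-injective : (∣p∣≡r : ∣ p ∣ ≡ r) (∣q∣≡r : ∣ q ∣ ≡ r) → rank p ∣p∣≡r ≡ rank q ∣q∣≡r → p ≡ q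
rank-injective {p = p} {q = q} ∣p∣≡r ∣q∣≡r =
  ∈-index-injective (∈-subsetsOfSize p ∣p∣≡r) (∈-subsetsOfSize q ∣q∣≡r)

-- Counting

injective⇒surjective : ∀ {a b} {g : Fin a → Fin b} → Injective _≡_ _≡_ g → b ≤ a →
                       ∀ y → ∃ λ x → g x ≡ y
injective⇒surjective {a} {b} {g} g-injective b≤a y with any? (λ x → g x ≟ᶠ y)
... | yes hit = hit
... | no miss = ⊥-elim (≤⇒≯ b≤a (injective⇒≤ {f = extended} extended-injective))
  where
    extended : Fin (suc a) → Fin b
    extended zero = y
    extended (suc x) = g x
    extended-injective : Injective _≡_ _≡_ extended
    extended-injective {zero} {zero} _ = refl
    extended-injective {zero} {suc x} y≡gx = ⊥-elim (miss (x , sym y≡gx))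
    extended-injective {suc x} {zero} gx≡y = ⊥-elim (miss (x , gx≡y))
    extended-injective {suc x} {suc x′} gx≡gx′ = cong suc (g-injective gx≡gx′)

remQuot-injective : ∀ k → Injective _≡_ _≡_ (remQuot {m} k)
remQuot-injective {m} k {i} {j} same =
  trans (sym (combine-remQuot {m} k i)) (trans (cong (uncurry combine) same) (combine-remQuot {m} k j))

shadow-covers : (f : Fin m → Subset n) → (∀ i → ∣ f i ∣ ≡ suc r) → Injective _≡_ _≡_ f →
                (∀ i j → i ≢ j → ∣ f i ∩ f j ∣ ≢ r) → n C r ≤ m * suc r →
                ∀ S → ∣ S ∣ ≡ r → ∃ λ i → S ⊆ f i
shadow-covers {m} {n} {r} f ∣f∣≡1+r f-injective f-nonadjacent nCr≤m*[1+r] S ∣S∣≡r =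
  proj₁ deletion , λ y∈S → p─q⊆p (f (proj₁ deletion)) _ (subst (_ ∈_) (sym shadow≡S) y∈S)
  where
    removed : ∀ i → Fin (suc r) → Fin n
    removed i t = element (f i) (subst Fin (sym (∣f∣≡1+r i)) t)

    removed-∈ : ∀ i t → removed i t ∈ f i
    removed-∈ i t = element-∈ (f i) _

    shadow : Fin m × Fin (suc r) → Subset n
    shadow (i , t) = f i - removed i t

    ∣shadow∣ : ∀ a → ∣ shadow a ∣ ≡ r
    ∣shadow∣ (i , t) = x∈p∧∣p∣≡1+r⇒∣p-x∣≡r (removed-∈ i t) (∣f∣≡1+r i)

    index-determined : ∀ i j t → shadow (i , t) ⊆ f j → i ≡ j
    index-determined i j t shadow⊆fj with i ≟ᶠ j
    ... | yes i≡j = i≡j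
    ... | no i≢j = ⊥-elim (f-nonadjacent i j i≢j (≤-antisym upper lower))
      where
        upper : ∣ f i ∩ f j ∣ ≤ r
        upper = ≤-pred (p≢q⇒∣p∩q∣<s (∣f∣≡1+r i) (∣f∣≡1+r j) (i≢j ∘ f-injective))
        lower : r ≤ ∣ f i ∩ f j ∣
        lower = subst (_≤ ∣ f i ∩ f j ∣) (∣shadow∣ (i , t))
                  (p⊆q⇒∣p∣≤∣q∣ (λ y∈ → x∈p∩q⁺ (p─q⊆p (f i) _ y∈ , shadow⊆fj y∈)))

    shadow-injective : Injective _≡_ _≡_ shadow
    shadow-injective {i , s} {j , t} same
      with refl ← index-determined i j s (λ y∈ → p─q⊆p (f j) _ (subst (_ ∈_) same y∈)) =
      cong (i ,_) (subst-injective (sym (∣f∣≡1+r i))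
        (element-injective (f i) (x∈p∧p-x≡p-y⇒x≡y (removed-∈ i s) same)))

    code : Fin (m * suc r) → Fin (length (subsetsOfSize n r))
    code x = rank (shadow (remQuot (suc r) x)) (∣shadow∣ (remQuot (suc r) x))

    code-injective : Injective _≡_ _≡_ code
    code-injective {x} {y} same = remQuot-injective (suc r)
      (shadow-injective (rank-injective (∣shadow∣ (remQuot (suc r) x)) (∣shadow∣ (remQuot (suc r) y)) same))

    hit : ∃ λ x → code x ≡ rank S ∣S∣≡r
    hit = injective⇒surjective code-injective
            (subst (_≤ m * suc r) (sym (length-subsetsOfSize n r)) nCr≤m*[1+r]) (rank S ∣S∣≡r)

    deletion : Fin m × Fin (suc r)
    deletion = remQuot (suc r) (proj₁ hit)

    shadow≡S : shadow deletion ≡ S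
    shadow≡S = rank-injective (∣shadow∣ deletion) ∣S∣≡r (proj₂ hit)

-- Binomial coefficients

[1+k]*[1+n]C[1+k]≡[1+n]*nCk : ∀ n k → suc k * (suc n C suc k) ≡ suc n * (n C k)
[1+k]*[1+n]C[1+k]≡[1+n]*nCk 0 0 = refl
[1+k]*[1+n]C[1+k]≡[1+n]*nCk 0 (suc k) = *-zeroʳ (suc (suc k))
[1+k]*[1+n]C[1+k]≡[1+n]*nCk (suc n) 0 =
  trans (+-identityʳ _) (trans (nC1≡n (suc (suc n))) (sym (*-identityʳ _)))
[1+k]*[1+n]C[1+k]≡[1+n]*nCk (suc n) (suc k) = begin
  suc (suc k) * (suc (suc n) C suc (suc k))
    ≡⟨ cong (suc (suc k) *_) (sym (nCk+nC[k+1]≡[n+1]C[k+1] (suc n) (suc k))) ⟩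
  suc (suc k) * (A + B)
    ≡⟨ distribute (suc k) A B ⟩
  suc k * A + A + suc (suc k) * B
    ≡⟨ cong₂ (λ a b → a + A + b) ([1+k]*[1+n]C[1+k]≡[1+n]*nCk n k) ([1+k]*[1+n]C[1+k]≡[1+n]*nCk n (suc k)) ⟩
  suc n * (n C k) + A + suc n * (n C suc k)
    ≡⟨ collect (suc n) (n C k) A (n C suc k) ⟩
  suc n * (n C k + n C suc k) + A
    ≡⟨ cong (λ a → suc n * a + A) (nCk+nC[k+1]≡[n+1]C[k+1] n k) ⟩
  suc n * A + A
    ≡⟨ +-comm (suc n * A) A ⟩
  suc (suc n) * A
    ∎
  where
    open ≡-Reasoning
    A B : ℕ
    A = suc n C suc k
    B = suc n C suc (suc k)
    distribute : ∀ k a b → suc k * (a + b) ≡ k * a + a + suc k * b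
    distribute = solve-∀
    collect : ∀ m a c b → m * a + c + m * b ≡ m * (a + b) + c
    collect = solve-∀

central-binomial-ratio : ∀ k → ((suc k + suc k) C suc k) * suc k ≡ ((suc k + suc k) C k) * suc (suc k)
central-binomial-ratio k = begin
  (suc N C suc k) * suc k                ≡⟨ *-comm (suc N C suc k) (suc k) ⟩
  suc k * (suc N C suc k)                ≡⟨ [1+k]*[1+n]C[1+k]≡[1+n]*nCk N k ⟩
  suc N * (N C k)                        ≡⟨ cong (suc N *_) NCk≡NC[1+k] ⟩
  suc N * (N C suc k)                    ≡⟨ sym ([1+k]*[1+n]C[1+k]≡[1+n]*nCk N (suc k)) ⟩
  suc (suc k) * (suc N C suc (suc k))    ≡⟨ cong (suc (suc k) *_) [1+N]C[2+k]≡[1+N]Ck ⟩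
  suc (suc k) * (suc N C k)              ≡⟨ *-comm (suc (suc k)) (suc N C k) ⟩
  (suc N C k) * suc (suc k)              ∎
  where
    open ≡-Reasoning
    N : ℕ
    N = k + suc k
    NCk≡NC[1+k] : N C k ≡ N C suc k
    NCk≡NC[1+k] = trans (nCk≡nC[n∸k] (m≤m+n k (suc k))) (cong (N C_) (m+n∸m≡n k (suc k)))
    [1+N]C[2+k]≡[1+N]Ck : suc N C suc (suc k) ≡ suc N C k
    [1+N]C[2+k]≡[1+N]Ck =
      trans (nCk≡nC[n∸k] (s≤s (m≤n+m (suc k) k))) (cong (suc N C_) (m+n∸n≡m k (suc k)))

x*k≡y*[1+k]⇒x/[1+k]*k≡y : ∀ x y k → x * k ≡ y * suc k → x / suc k * k ≡ y
x*k≡y*[1+k]⇒x/[1+k]*k≡y x y k x*k≡y*[1+k] = begin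
  x / suc k * k        ≡⟨ cong (λ z → z / suc k * k) x≡[x∸y]*[1+k] ⟩
  (x ∸ y) * suc k / suc k * k ≡⟨ cong (_* k) (m*n/n≡m (x ∸ y) (suc k)) ⟩
  (x ∸ y) * k          ≡⟨ *-distribʳ-∸ k x y ⟩
  x * k ∸ y * k        ≡⟨ cong (_∸ y * k) (trans x*k≡y*[1+k] (*-suc y k)) ⟩
  y + y * k ∸ y * k    ≡⟨ m+n∸n≡m y (y * k) ⟩
  y                    ∎
  where
    open ≡-Reasoning
    x≡[x∸y]*[1+k] : x ≡ (x ∸ y) * suc k
    x≡[x∸y]*[1+k] = sym (begin
      (x ∸ y) * suc k        ≡⟨ *-distribʳ-∸ (suc k) x y ⟩
      x * suc k ∸ y * suc k  ≡⟨ cong₂ _∸_ (*-suc x k) (sym x*k≡y*[1+k]) ⟩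
      x + x * k ∸ x * k      ≡⟨ m+n∸n≡m x (x * k) ⟩
      x                      ∎)

catalan[1+k]*[1+k]≡[2+2k]Ck : ∀ k → catalan (suc k) * suc k ≡ (2 * suc k) C k
catalan[1+k]*[1+k]≡[2+2k]Ck k =
  subst (λ N → ((N C suc k) / suc (suc k)) * suc k ≡ N C k) (sym (cong (suc k +_) (+-identityʳ (suc k))))
    (x*k≡y*[1+k]⇒x/[1+k]*k≡y ((suc k + suc k) C suc k) _ (suc k) (central-binomial-ratio k))

-- Graphs

independent≤cliqueCover : ∀ {G m m′} → IndependentSet G m → CliqueCover G m′ → m ≤ m′
independent≤cliqueCover {G} {m} {m′} (f , f-injective , f-independent) (C , C-clique , C-covers) =
  injective⇒≤ {f = cliqueOf} cliqueOf-injective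
  where
    cliqueOf : Fin m → Fin m′
    cliqueOf i = proj₁ (C-covers (f i))

    cliqueOf-injective : Injective _≡_ _≡_ cliqueOf
    cliqueOf-injective {i} {j} same with i ≟ᶠ j
    ... | yes i≡j = i≡j
    ... | no i≢j = ⊥-elim (f-independent i j i≢j
          (C-clique (cliqueOf i) (f i) (f j) (proj₂ (C-covers (f i)))
            (subst (λ c → C c (f j) ≡ true) (sym same) (proj₂ (C-covers (f j))))
            (i≢j ∘ f-injective)))

JVertex-≡ : ∀ {k} {u v : JVertex n k} → proj₁ u ≡ proj₁ v → u ≡ v
JVertex-≡ u≡v = Σ-≡,≡→≡ (u≡v , ≡-irrelevant _ _)

common-subset⇒∣∩∣≡ : ∀ {S u v : Subset n} → ∣ S ∣ ≡ r → ∣ u ∣ ≡ suc r → ∣ v ∣ ≡ suc r → u ≢ v →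
                     S ⊆ u → S ⊆ v → ∣ u ∩ v ∣ ≡ r
common-subset⇒∣∩∣≡ {u = u} {v} ∣S∣≡r ∣u∣≡1+r ∣v∣≡1+r u≢v S⊆u S⊆v =
  ≤-antisym (≤-pred (p≢q⇒∣p∩q∣<s ∣u∣≡1+r ∣v∣≡1+r u≢v))
            (subst (_≤ ∣ u ∩ v ∣) ∣S∣≡r (p⊆q⇒∣p∣≤∣q∣ (λ y∈S → x∈p∩q⁺ (S⊆u y∈S , S⊆v y∈S))))

common-superset⇒∣∩∣≡ : ∀ {T u v : Subset n} → ∣ T ∣ ≡ suc (suc r) → ∣ u ∣ ≡ suc r → ∣ v ∣ ≡ suc r →
                       u ≢ v → u ⊆ T → v ⊆ T → ∣ u ∩ v ∣ ≡ r
common-superset⇒∣∩∣≡ {r = r} {u = u} {v} ∣T∣≡2+r ∣u∣≡1+r ∣v∣≡1+r u≢v u⊆T v⊆T =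
  ≤-antisym (≤-pred (p≢q⇒∣p∩q∣<s ∣u∣≡1+r ∣v∣≡1+r u≢v)) (+-cancelʳ-≤ (suc (suc r)) r ∣ u ∩ v ∣ sum≤)
  where
    ∣u∪v∣≤2+r : ∣ u ∪ v ∣ ≤ suc (suc r)
    ∣u∪v∣≤2+r = subst (∣ u ∪ v ∣ ≤_) ∣T∣≡2+r
      (p⊆q⇒∣p∣≤∣q∣ (λ y∈ → [ u⊆T , v⊆T ] (x∈p∪q⁻ u v y∈)))
    sum≤ : r + suc (suc r) ≤ ∣ u ∩ v ∣ + suc (suc r)
    sum≤ = begin
      r + suc (suc r)              ≡⟨ +-suc r (suc r) ⟩
      suc r + suc r                ≡⟨ sym (trans (∣p∩q∣+∣p∪q∣≡∣p∣+∣q∣ u v) (cong₂ _+_ ∣u∣≡1+r ∣v∣≡1+r)) ⟩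
      ∣ u ∩ v ∣ + ∣ u ∪ v ∣        ≤⟨ +-monoʳ-≤ ∣ u ∩ v ∣ ∣u∪v∣≤2+r ⟩
      ∣ u ∩ v ∣ + suc (suc r)      ∎
      where open ≤-Reasoning

-- For x ∈ c these are the k-sets containing c − x, for x ∉ c the k-sets inside c ∪ {x}: in either
-- case the other disjunct only adds c itself.
InPivotClique : Fin n → Subset n → Subset n → Set
InPivotClique x c v = c ⊆ v ∪ ⁅ x ⁆ ⊎ v ⊆ c ∪ ⁅ x ⁆

inPivotClique? : (x : Fin n) (c v : Subset n) → Dec (InPivotClique x c v)
inPivotClique? x c v = (c ⊆? v ∪ ⁅ x ⁆) ⊎-dec (v ⊆? c ∪ ⁅ x ⁆)

pivotClique : ∀ {k} → Fin n → Subset n → JVertex n k → Bool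
pivotClique x c v = does (inPivotClique? x c (proj₁ v))

does≡true⇒ : ∀ {A : Set} (a? : Dec A) → does a? ≡ true → A
does≡true⇒ (yes a) _ = a

inPivotClique⇒c-x⊆v : ∀ {c v : Subset n} → ∣ v ∣ ≡ ∣ c ∣ → x ∈ c → InPivotClique x c v → c - x ⊆ v
inPivotClique⇒c-x⊆v _ _ (inj₁ c⊆v∪⁅x⁆) = p⊆q∪⁅x⁆⇒p-x⊆q c⊆v∪⁅x⁆
inPivotClique⇒c-x⊆v {c = c} ∣v∣≡∣c∣ x∈c (inj₂ v⊆c∪⁅x⁆) y∈c-x =
  subst (_ ∈_) (sym (∣p∣≡∣q∣∧p⊆q⇒p≡q ∣v∣≡∣c∣ (p⊆q∪⁅x⁆⇒p⊆q v⊆c∪⁅x⁆ (λ _ → x∈c)))) (p─q⊆p c _ y∈c-x)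

inPivotClique⇒v⊆c∪⁅x⁆ : ∀ {c v : Subset n} → ∣ c ∣ ≡ ∣ v ∣ → x ∉ c → InPivotClique x c v → v ⊆ c ∪ ⁅ x ⁆
inPivotClique⇒v⊆c∪⁅x⁆ {x = x} {c} ∣c∣≡∣v∣ x∉c (inj₁ c⊆v∪⁅x⁆) y∈v =
  p⊆p∪q ⁅ x ⁆ (subst (_ ∈_) (sym (∣p∣≡∣q∣∧p⊆q⇒p≡q ∣c∣≡∣v∣ (p⊆q∪⁅x⁆⇒p⊆q c⊆v∪⁅x⁆ (⊥-elim ∘ x∉c)))) y∈v)
inPivotClique⇒v⊆c∪⁅x⁆ _ _ (inj₂ v⊆c∪⁅x⁆) = v⊆c∪⁅x⁆

pivotClique-isClique : ∀ x (c : JVertex n (suc r)) → IsClique (Johnson n (suc r)) (pivotClique x (proj₁ c))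
pivotClique-isClique {r = r} x (c , ∣c∣≡1+r) (u , ∣u∣≡1+r) (v , ∣v∣≡1+r) u∈ v∈ u≢v with x ∈? c
... | yes x∈c =
  common-subset⇒∣∩∣≡ (x∈p∧∣p∣≡1+r⇒∣p-x∣≡r x∈c ∣c∣≡1+r) ∣u∣≡1+r ∣v∣≡1+r
    (u≢v ∘ JVertex-≡) (c-x⊆ ∣u∣≡1+r u∈) (c-x⊆ ∣v∣≡1+r v∈)
  where
    c-x⊆ : ∀ {w} → ∣ w ∣ ≡ suc r → does (inPivotClique? x c w) ≡ true → c - x ⊆ w
    c-x⊆ {w} ∣w∣≡1+r w∈ =
      inPivotClique⇒c-x⊆v (trans ∣w∣≡1+r (sym ∣c∣≡1+r)) x∈c (does≡true⇒ (inPivotClique? x c w) w∈)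
... | no x∉c =
  common-superset⇒∣∩∣≡ (trans (x∉p⇒∣p∪⁅x⁆∣≡suc∣p∣ x∉c) (cong suc ∣c∣≡1+r)) ∣u∣≡1+r ∣v∣≡1+r
    (u≢v ∘ JVertex-≡) (⊆c∪⁅x⁆ ∣u∣≡1+r u∈) (⊆c∪⁅x⁆ ∣v∣≡1+r v∈)
  where
    ⊆c∪⁅x⁆ : ∀ {w} → ∣ w ∣ ≡ suc r → does (inPivotClique? x c w) ≡ true → w ⊆ c ∪ ⁅ x ⁆
    ⊆c∪⁅x⁆ {w} ∣w∣≡1+r w∈ =
      inPivotClique⇒v⊆c∪⁅x⁆ (trans ∣c∣≡1+r (sym ∣w∣≡1+r)) x∉c (does≡true⇒ (inPivotClique? x c w) w∈)

pivotCliqueCover : ∀ r → IndependentSet (Johnson (2 * suc r) (suc r)) (catalan (suc r)) →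
                   CliqueCover (Johnson (2 * suc r) (suc r)) (catalan (suc r))
pivotCliqueCover r (f , f-injective , f-independent) =
  (λ i → pivotClique zero (sets i)) , (λ i → pivotClique-isClique zero (f i)) , covered
  where
    N : ℕ
    N = 2 * suc r

    N≡[1+r]+[1+r] : N ≡ suc r + suc r
    N≡[1+r]+[1+r] = cong (suc r +_) (+-identityʳ (suc r))

    ∣∁p∣≡1+r : (p : Subset N) → ∣ p ∣ ≡ suc r → ∣ ∁ p ∣ ≡ suc r
    ∣∁p∣≡1+r p ∣p∣≡1+r =
      trans (∣∁p∣≡n∸∣p∣ p) (trans (cong₂ _∸_ N≡[1+r]+[1+r] ∣p∣≡1+r) (m+n∸m≡n (suc r) (suc r)))

    sets : Fin (catalan (suc r)) → Subset N
    sets = proj₁ ∘ f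

    sets-injective : Injective _≡_ _≡_ sets
    sets-injective = f-injective ∘ JVertex-≡

    ∣∁sets∩∁sets∣ : ∀ i j → ∣ ∁ (sets i) ∩ ∁ (sets j) ∣ ≡ ∣ sets i ∩ sets j ∣
    ∣∁sets∩∁sets∣ i j = ∣∁p∩∁q∣≡∣p∩q∣ (sets i) (sets j)
      (trans (cong₂ _+_ (proj₂ (f i)) (proj₂ (f j))) (sym N≡[1+r]+[1+r]))

    bound : N C r ≤ catalan (suc r) * suc r
    bound = ≤-reflexive (sym (catalan[1+k]*[1+k]≡[2+2k]Ck r))

    below : ∀ S → ∣ S ∣ ≡ r → ∃ λ i → S ⊆ sets i
    below = shadow-covers sets (proj₂ ∘ f) sets-injective f-independent bound

    above : ∀ S → ∣ S ∣ ≡ r → ∃ λ i → S ⊆ ∁ (sets i)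
    above = shadow-covers (∁ ∘ sets) (λ i → ∣∁p∣≡1+r (sets i) (proj₂ (f i)))
              (sets-injective ∘ ∁-injective)
              (λ i j i≢j → f-independent i j i≢j ∘ trans (sym (∣∁sets∩∁sets∣ i j))) bound

    covered : ∀ v → ∃ λ i → pivotClique zero (sets i) v ≡ true
    covered (v , ∣v∣≡1+r) = byPivot (zero ∈? v)
      where
        member : ∀ i → InPivotClique zero (sets i) v → pivotClique zero (sets i) (v , ∣v∣≡1+r) ≡ true
        member i = dec-true (inPivotClique? zero (sets i) v)

        byPivot : Dec (zero ∈ v) → ∃ λ i → pivotClique zero (sets i) (v , ∣v∣≡1+r) ≡ true
        byPivot (yes 0∈v) =
          let i , v-0⊆ = below (v - zero) (x∈p∧∣p∣≡1+r⇒∣p-x∣≡r 0∈v ∣v∣≡1+r)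
          in i , member i (inj₂ (p-x⊆q⇒p⊆q∪⁅x⁆ {x = zero} v-0⊆))
        byPivot (no 0∉v) =
          let i , ∁v-0⊆ = above (∁ v - zero) (x∈p∧∣p∣≡1+r⇒∣p-x∣≡r (x∉p⇒x∈∁p 0∉v) (∣∁p∣≡1+r v ∣v∣≡1+r))
          in i , member i (inj₁ (∁p-x⊆∁q⇒q⊆p∪⁅x⁆ {x = zero} ∁v-0⊆))

corollary4p3 : (k : ℕ) → 1 ≤ k →
    IsIndependenceNumber (Johnson (2 * k) k) (catalan k) →
    IsCliqueCoverNumber (Johnson (2 * k) k) (catalan k)
corollary4p3 (suc r) _ (independent , _) =
  pivotCliqueCover r independent , λ _ cover → independent≤cliqueCover independent cover
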